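{- Let $x,n_1,\dots,n_S$ be natural numbers such that there exists a ground term of weight $x$ with contents $(n_1,\dots,n_S)$, and suppose $n_1+\dots+n_B\ge 1$ and $n_1+\dots+n_F\ge N$. Then there exist at least $N$ different ground terms with contents $(n_1,\dots,n_S)$.
   Context: $\Sigma$ is a fixed finite signature with at least one constant and a fixed weight function $w:\Sigma\to\mathbb{N}$ ($w(a)>0$ for constants, at most one unary symbol of weight 0); weight of ground terms: $|c|=w(c)$, $|g(t_1,\dots,t_n)|=w(g)+\sum|t_i|$. The symbols of $\Sigma$ are enumerated $g_1,\dots,g_S$ so that $g_1,\dots,g_B$ are exactly the symbols of arity $\ge 2$ and $g_1,\dots,g_F$ are exactly the non-constant symbols (so $g_{B+1},\dots,g_F$ are the unary symbols). The contents of a ground term is $(n_1,\dots,n_S)$ with $n_i$ the number of occurrences of $g_i$ in it. -}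

module Defs where

open import Data.Nat using (ℕ; zero; suc; _+_; _<_; _≤_)
open import Data.Fin using (Fin; toℕ)
open import Data.Vec using (Vec; []; _∷_; sum; tabulate)
open import Data.Product using (_×_)
open import Data.Bool using (if_then_else_)
open import Relation.Nullary.Decidable using (does)
open import Relation.Binary.PropositionalEquality using (_≡_)
open import Data.Nat using (_<?_)

-- A finite signature Σ with symbols g_0 … g_{S-1} (0-indexed Fin S),
-- enumerated so that the first B symbols are exactly those of arity ≥ 2
-- and the first F symbols are exactly the non-constant ones;
-- together with a weight function satisfying the standing assumptions.
record Signature : Set where
  field
    S B F     : ℕ
    arity     : Fin S → ℕ
    w         : Fin S → ℕ
    B≤F       : B ≤ F
    F<S       : F < S                      -- at least one constant
    arity≥2⇔  : ∀ i → (2 ≤ arity i → toℕ i < B) × (toℕ i < B → 2 ≤ arity i)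
    arity≥1⇔  : ∀ i → (1 ≤ arity i → toℕ i < F) × (toℕ i < F → 1 ≤ arity i)
    const-pos : ∀ i → arity i ≡ 0 → 0 < w i
    unary0    : ∀ i j → arity i ≡ 1 → arity j ≡ 1 → w i ≡ 0 → w j ≡ 0 → i ≡ j

module _ (Σ : Signature) where
  open Signature Σ

  data Term : Set where
    node : (i : Fin S) → Vec Term (arity i) → Term

  mutual
    weight : Term → ℕ
    weight (node i ts) = w i + weights ts

    weights : ∀ {k} → Vec Term k → ℕ
    weights [] = 0
    weights (t ∷ ts) = weight t + weights ts

  open import Data.Fin using (_≟_)

  mutual
    occ : Fin S → Term → ℕ
    occ j (node i ts) = (if does (i ≟ j) then 1 else 0) + occs j ts

    occs : ∀ {k} → Fin S → Vec Term k → ℕ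
    occs j [] = 0
    occs j (t ∷ ts) = occ j t + occs j ts

  HasContents : Term → (Fin S → ℕ) → Set
  HasContents t n = ∀ j → occ j t ≡ n j

  -- n_1 + … + n_K  (sum of n j over the symbols with index < K)
  sumBelow : ℕ → (Fin S → ℕ) → ℕ
  sumBelow K n = sum (tabulate (λ i → if does (toℕ i <? K) then n i else 0))

{-# OPTIONS --safe #-}
-- Every term has the same contents as a caterpillar: all its non-constant
-- nodes lie on the leftmost branch, each carrying only constants in its other
-- argument positions, so the caterpillar is a list of M = n₁ + … + n_F pieces
-- above a bottom constant.  Take a piece g of arity ≥ 2 out and put it at the
-- root; as its first two arguments give it the caterpillar of the first k
-- remaining pieces (over the old bottom) and that of the other M - 1 - k
-- (over one of g's side constants).  For k = 0, …, M - 1 this yields M terms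
-- with the same contents, pairwise distinct because their leftmost branches
-- have length k + 1.
module Submission where

open import Defs
open import Data.Nat using (ℕ; _≤_)
open import Data.Fin using (Fin)
open import Data.Product using (Σ-syntax; ∃-syntax; _×_)
open import Relation.Binary.PropositionalEquality using (_≡_)
open import Function.Definitions using (Injective)

open import Data.Bool using (if_then_else_)
open import Data.Fin using (zero; suc; toℕ; _≟_; inject≤)
open import Data.Fin.Properties using (toℕ-injective; toℕ<n; inject≤-injective)
open import Data.List using (List; []; _∷_; _++_; length; take; drop)
open import Data.List.Membership.Propositional using (find)
open import Data.List.Membership.Propositional.Properties using (∈-∃++)
open import Data.List.Properties using (length-take; take++drop≡id; map-++; map-cong; length-++-sucʳ)
open import Data.List.Relation.Binary.Permutation.Propositional using (_↭_)
open import Data.List.Relation.Binary.Permutation.Propositional.Properties using (shift)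
import Data.List.Relation.Binary.Permutation.Propositional.Properties as ↭
open import Data.List.Relation.Unary.Any using (Any; here; there)
open import Data.Nat using (zero; suc; _+_; _<_; _⊓_; z≤n; s≤s; _<?_)
open import Data.Nat.ListAction using (sum)
open import Data.Nat.ListAction.Properties using (sum-++; sum-↭)
open import Data.Nat.Properties using (+-mono-≤; ≤-trans; <-≤-trans; +-identityʳ; +-assoc; ≤-reflexive; ≤-pred; suc-injective; m≤n⇒m⊓n≡m; module ≤-Reasoning)
open import Data.Nat.Tactic.RingSolver using (solve-∀)
open import Data.Product using (_,_; proj₁; proj₂)
open import Data.Vec using (Vec; []; _∷_; tabulate)
import Data.Vec as Vec
open import Function using (_∘_)
open import Relation.Binary.PropositionalEquality using (refl; sym; trans; cong; cong₂; subst; _≢_; module ≡-Reasoning)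
open import Relation.Nullary using (Dec; does; yes; no)
open import Relation.Nullary.Decidable using (dec-false)

δ : ∀ {n} → Fin n → Fin n → ℕ
δ i j = if does (i ≟ j) then 1 else 0

δ-≢ : ∀ {n} {i j : Fin n} → i ≢ j → δ i j ≡ 0
δ-≢ {i = i} {j} i≢j = cong (λ b → if b then 1 else 0) (dec-false (i ≟ j) i≢j)

sum-tabulate-+ : ∀ {n} (f g : Fin n → ℕ) →
  Vec.sum (tabulate (λ i → f i + g i)) ≡ Vec.sum (tabulate f) + Vec.sum (tabulate g)
sum-tabulate-+ {zero}  f g = refl
sum-tabulate-+ {suc n} f g =
  trans (cong (f zero + g zero +_) (sum-tabulate-+ (f ∘ suc) (g ∘ suc))) (interchange (f zero) (g zero) _ _)
  where
    interchange : ∀ a b c d → (a + b) + (c + d) ≡ (a + c) + (b + d)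
    interchange = solve-∀

sum-tabulate-0 : ∀ n → Vec.sum (tabulate {n = n} (λ _ → 0)) ≡ 0
sum-tabulate-0 zero    = refl
sum-tabulate-0 (suc n) = sum-tabulate-0 n

sum-tabulate-δ : ∀ {n} (i : Fin n) → Vec.sum (tabulate (δ i)) ≡ 1
sum-tabulate-δ {suc n} zero    = cong suc (sum-tabulate-0 n)
sum-tabulate-δ         (suc i) = sum-tabulate-δ i

sum-tabulate-mono : ∀ {n} {f g : Fin n → ℕ} → (∀ i → f i ≤ g i) →
  Vec.sum (tabulate f) ≤ Vec.sum (tabulate g)
sum-tabulate-mono {zero}  f≤g = z≤n
sum-tabulate-mono {suc n} f≤g = +-mono-≤ (f≤g zero) (sum-tabulate-mono (f≤g ∘ suc))

sum-tabulate-pos : ∀ {n} (f : Fin n → ℕ) → 1 ≤ Vec.sum (tabulate f) → ∃[ i ] 1 ≤ f i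
sum-tabulate-pos {suc n} f h with f zero in f₀
... | suc _ = zero , subst (1 ≤_) (sym f₀) (s≤s z≤n)
... | zero  = let i , fi = sum-tabulate-pos (f ∘ suc) h in suc i , fi

pos-if-does : ∀ {P : Set} {x} (d : Dec P) → 1 ≤ (if does d then x else 0) → P × 1 ≤ x
pos-if-does (yes p) h = p , h
pos-if-does (no _)  ()

if-does-≤ : ∀ {P : Set} {x y} (d : Dec P) → (P → x ≤ y) → (if does d then x else 0) ≤ y
if-does-≤ (yes p) x≤y = x≤y p
if-does-≤ (no _)  _   = z≤n

AtLeast : ℕ → {A : Set} → (A → Set) → Set
AtLeast N {A} P = Σ[ f ∈ (Fin N → A) ] (Injective _≡_ _≡_ f × ∀ k → P (f k))

AtLeast-≤ : ∀ {N M} {A : Set} {P : A → Set} → N ≤ M → AtLeast M P → AtLeast N P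
AtLeast-≤ N≤M (f , f-inj , Pf) =
  (λ k → f (inject≤ k N≤M)) , (λ {k} {l} → inject≤-injective N≤M N≤M k l ∘ f-inj) , (λ k → Pf (inject≤ k N≤M))

module Caterpillars (Sg : Signature) where
  open Signature Sg

  node′ : ∀ {m} (g : Fin S) → arity g ≡ m → Vec (Term Sg) m → Term Sg
  node′ g p ts = node g (subst (Vec (Term Sg)) (sym p) ts)

  occ-node′ : ∀ {m} j g (p : arity g ≡ m) (ts : Vec (Term Sg) m) → occ Sg j (node′ g p ts) ≡ δ g j + occs Sg j ts
  occ-node′ j g refl ts = refl

  mutual
    leftDepth : Term Sg → ℕ
    leftDepth (node g ts) = leftDepthArgs ts

    leftDepthArgs : ∀ {k} → Vec (Term Sg) k → ℕ
    leftDepthArgs []      = 0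
    leftDepthArgs (t ∷ _) = suc (leftDepth t)

  leftDepth-node′ : ∀ {m} g (p : arity g ≡ m) (ts : Vec (Term Sg) m) → leftDepth (node′ g p ts) ≡ leftDepthArgs ts
  leftDepth-node′ g refl ts = refl

  Const : Set
  Const = Σ[ c ∈ Fin S ] arity c ≡ 0

  leaf : Const → Term Sg
  leaf (c , p) = node′ c p []

  leftDepth-leaf : ∀ c → leftDepth (leaf c) ≡ 0
  leftDepth-leaf (c , p) = leftDepth-node′ c p []

  occ-leaf-nonconstant : ∀ {j} (c : Const) → 1 ≤ arity j → occ Sg j (leaf c) ≡ 0
  occ-leaf-nonconstant {j} (c , p) 1≤arity = begin
    occ Sg j (node′ c p []) ≡⟨ occ-node′ j c p [] ⟩
    δ c j + 0               ≡⟨ cong (_+ 0) (δ-≢ c≢j) ⟩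
    0                       ∎
    where
      open ≡-Reasoning
      c≢j : c ≢ j
      c≢j refl with subst (1 ≤_) p 1≤arity
      ... | ()

  occs-leaves-nonconstant : ∀ {j k} (cs : Vec Const k) → 1 ≤ arity j → occs Sg j (Vec.map leaf cs) ≡ 0
  occs-leaves-nonconstant []       _        = refl
  occs-leaves-nonconstant (c ∷ cs) 1≤arity =
    cong₂ _+_ (occ-leaf-nonconstant c 1≤arity) (occs-leaves-nonconstant cs 1≤arity)

  -- A non-constant symbol with its first argument left open and the others
  -- filled by the constants side.
  record Piece : Set where
    constructor piece
    field
      symbol       : Fin S
      {extra}      : ℕ
      symbol-arity : arity symbol ≡ suc extra
      side         : Vec Const extra
  open Piece

  comb : List Piece → Term Sg → Term Sg
  comb []                 u = u
  comb (piece g p cs ∷ P) u = node′ g p (comb P u ∷ Vec.map leaf cs)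

  occPiece : Fin S → Piece → ℕ
  occPiece j (piece g _ cs) = δ g j + occs Sg j (Vec.map leaf cs)

  occPieces : Fin S → List Piece → ℕ
  occPieces j P = sum (Data.List.map (occPiece j) P)

  countSymbol : Fin S → List Piece → ℕ
  countSymbol j P = sum (Data.List.map (λ x → δ (symbol x) j) P)

  occPieces-++ : ∀ j P Q → occPieces j (P ++ Q) ≡ occPieces j P + occPieces j Q
  occPieces-++ j P Q = trans (cong sum (map-++ (occPiece j) P Q)) (sum-++ (Data.List.map (occPiece j) P) _)

  occ-comb : ∀ j P u → occ Sg j (comb P u) ≡ occPieces j P + occ Sg j u
  occ-comb j []                 u = refl
  occ-comb j (piece g p cs ∷ P) u = begin
    occ Sg j (node′ g p (comb P u ∷ Vec.map leaf cs)) ≡⟨ occ-node′ j g p _ ⟩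
    δ g j + (occ Sg j (comb P u) + ncs)               ≡⟨ cong (λ m → δ g j + (m + ncs)) (occ-comb j P u) ⟩
    δ g j + ((occPieces j P + occ Sg j u) + ncs)      ≡⟨ rearrange (δ g j) (occPieces j P) (occ Sg j u) ncs ⟩
    (δ g j + ncs) + occPieces j P + occ Sg j u        ∎
    where
      open ≡-Reasoning
      ncs = occs Sg j (Vec.map leaf cs)
      rearrange : ∀ d l u r → d + ((l + u) + r) ≡ (d + r) + l + u
      rearrange = solve-∀

  occ-comb-↭ : ∀ {P Q} j u → P ↭ Q → occ Sg j (comb P u) ≡ occ Sg j (comb Q u)
  occ-comb-↭ {P} {Q} j u P↭Q = begin
    occ Sg j (comb P u)       ≡⟨ occ-comb j P u ⟩
    occPieces j P + occ Sg j u ≡⟨ cong (_+ occ Sg j u) (sum-↭ (↭.map⁺ (occPiece j) P↭Q)) ⟩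
    occPieces j Q + occ Sg j u ≡⟨ occ-comb j Q u ⟨
    occ Sg j (comb Q u)       ∎
    where open ≡-Reasoning

  leftDepth-comb : ∀ P u → leftDepth (comb P u) ≡ length P + leftDepth u
  leftDepth-comb []                 u = refl
  leftDepth-comb (piece g p cs ∷ P) u = trans (leftDepth-node′ g p _) (cong suc (leftDepth-comb P u))

  occPieces-nonconstant : ∀ {j} P → 1 ≤ arity j → occPieces j P ≡ countSymbol j P
  occPieces-nonconstant {j} P 1≤arity = cong sum (map-cong occPiece-nonconstant P)
    where
      occPiece-nonconstant : ∀ x → occPiece j x ≡ δ (symbol x) j
      occPiece-nonconstant (piece g _ cs) =
        trans (cong (δ g j +_) (occs-leaves-nonconstant cs 1≤arity)) (+-identityʳ _)

  sum-countSymbol : ∀ P → Vec.sum (tabulate (λ j → countSymbol j P)) ≡ length P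
  sum-countSymbol []      = sum-tabulate-0 S
  sum-countSymbol (x ∷ P) =
    trans (sum-tabulate-+ (δ (symbol x)) (λ j → countSymbol j P))
          (cong₂ _+_ (sum-tabulate-δ (symbol x)) (sum-countSymbol P))

  countSymbol-pos : ∀ {j} P → 1 ≤ countSymbol j P → Any (λ x → symbol x ≡ j) P
  countSymbol-pos {j} (x ∷ P) h with symbol x ≟ j
  ... | yes eq = here eq
  ... | no _   = there (countSymbol-pos P h)

  -- The bottoms of the caterpillars of a node's arguments 2, 3, … become the
  -- side constants of its piece.
  mutual
    caterpillar : Term Sg → List Piece × Const
    caterpillar (node g ts) = caterpillarAt g refl ts

    caterpillarAt : ∀ {m} (g : Fin S) → arity g ≡ m → Vec (Term Sg) m → List Piece × Const
    caterpillarAt g p []       = [] , (g , p)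
    caterpillarAt g p (t ∷ ts) =
      let P , b = caterpillar t ; Q , bs = caterpillars ts in piece g p bs ∷ P ++ Q , b

    caterpillars : ∀ {k} → Vec (Term Sg) k → List Piece × Vec Const k
    caterpillars []       = [] , []
    caterpillars (t ∷ ts) =
      let P , b = caterpillar t ; Q , bs = caterpillars ts in P ++ Q , b ∷ bs

  pieces : Term Sg → List Piece
  pieces = proj₁ ∘ caterpillar

  bottom : Term Sg → Const
  bottom = proj₂ ∘ caterpillar

  mutual
    occ-caterpillar : ∀ j t → occ Sg j t ≡ occ Sg j (comb (pieces t) (leaf (bottom t)))
    occ-caterpillar j (node g ts) = occ-caterpillarAt j g refl ts

    occ-caterpillarAt : ∀ {m} j g (p : arity g ≡ m) (ts : Vec (Term Sg) m) →
      let P , b = caterpillarAt g p ts in δ g j + occs Sg j ts ≡ occ Sg j (comb P (leaf b))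
    occ-caterpillarAt j g p []         = sym (occ-node′ j g p [])
    occ-caterpillarAt j g p ts@(_ ∷ _) = begin
      δ g j + occs Sg j ts
        ≡⟨ cong (δ g j +_) (occs-caterpillars j ts) ⟩
      δ g j + (occPieces j P + (occ Sg j (leaf b) + occs Sg j (Vec.map leaf bs)))
        ≡⟨ cong (δ g j +_) (+-assoc (occPieces j P) _ _) ⟨
      δ g j + ((occPieces j P + occ Sg j (leaf b)) + occs Sg j (Vec.map leaf bs))
        ≡⟨ cong (λ m → δ g j + (m + occs Sg j (Vec.map leaf bs))) (occ-comb j P (leaf b)) ⟨
      δ g j + (occ Sg j (comb P (leaf b)) + occs Sg j (Vec.map leaf bs))
        ≡⟨ occ-node′ j g p _ ⟨
      occ Sg j (comb (piece g p bs ∷ P) (leaf b)) ∎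
      where
        open ≡-Reasoning
        P = proj₁ (caterpillars ts)
        b = Vec.head (proj₂ (caterpillars ts))
        bs = Vec.tail (proj₂ (caterpillars ts))

    occs-caterpillars : ∀ {k} j (ts : Vec (Term Sg) k) →
      let Q , bs = caterpillars ts in occs Sg j ts ≡ occPieces j Q + occs Sg j (Vec.map leaf bs)
    occs-caterpillars j []       = refl
    occs-caterpillars j (t ∷ ts) = begin
      occ Sg j t + occs Sg j ts
        ≡⟨ cong₂ _+_ (trans (occ-caterpillar j t) (occ-comb j P (leaf b))) (occs-caterpillars j ts) ⟩
      (occPieces j P + nb) + (occPieces j Q + nbs)
        ≡⟨ rearrange (occPieces j P) nb (occPieces j Q) nbs ⟩
      (occPieces j P + occPieces j Q) + (nb + nbs)
        ≡⟨ cong (_+ (nb + nbs)) (occPieces-++ j P Q) ⟨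
      occPieces j (P ++ Q) + occs Sg j (Vec.map leaf (b ∷ bs)) ∎
      where
        open ≡-Reasoning
        P = pieces t
        b = bottom t
        Q = proj₁ (caterpillars ts)
        bs = proj₂ (caterpillars ts)
        nb = occ Sg j (leaf b)
        nbs = occs Sg j (Vec.map leaf bs)
        rearrange : ∀ a b c d → (a + b) + (c + d) ≡ (a + c) + (b + d)
        rearrange = solve-∀

  module Fork {a} (g : Fin S) (p : arity g ≡ suc (suc a)) (c : Const) (cs : Vec Const a)
              (Q : List Piece) (b : Const) where

    fork : ℕ → Term Sg
    fork k = node′ g p (comb (take k Q) (leaf b) ∷ comb (drop k Q) (leaf c) ∷ Vec.map leaf cs)

    occ-fork : ∀ k j → occ Sg j (fork k) ≡ occ Sg j (comb (piece g p (c ∷ cs) ∷ Q) (leaf b))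
    occ-fork k j = begin
      occ Sg j (fork k)
        ≡⟨ occ-node′ j g p _ ⟩
      δ g j + (occ Sg j (comb Qₗ (leaf b)) + (occ Sg j (comb Qᵣ (leaf c)) + ncs))
        ≡⟨ cong₂ (λ l r → δ g j + (l + (r + ncs))) (occ-comb j Qₗ (leaf b)) (occ-comb j Qᵣ (leaf c)) ⟩
      δ g j + ((occPieces j Qₗ + nb) + ((occPieces j Qᵣ + nc) + ncs))
        ≡⟨ rearrange (δ g j) (occPieces j Qₗ) nb (occPieces j Qᵣ) nc ncs ⟩
      δ g j + (nc + ncs) + (occPieces j Qₗ + occPieces j Qᵣ) + nb
        ≡⟨ cong (λ m → δ g j + (nc + ncs) + m + nb) (occPieces-++ j Qₗ Qᵣ) ⟨
      occPieces j (x ∷ Qₗ ++ Qᵣ) + nb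
        ≡⟨ occ-comb j (x ∷ Qₗ ++ Qᵣ) (leaf b) ⟨
      occ Sg j (comb (x ∷ Qₗ ++ Qᵣ) (leaf b))
        ≡⟨ cong (λ P → occ Sg j (comb (x ∷ P) (leaf b))) (take++drop≡id k Q) ⟩
      occ Sg j (comb (x ∷ Q) (leaf b)) ∎
      where
        open ≡-Reasoning
        x = piece g p (c ∷ cs)
        Qₗ = take k Q
        Qᵣ = drop k Q
        nb = occ Sg j (leaf b)
        nc = occ Sg j (leaf c)
        ncs = occs Sg j (Vec.map leaf cs)
        rearrange : ∀ d l b r c cs → d + ((l + b) + ((r + c) + cs)) ≡ d + (c + cs) + (l + r) + b
        rearrange = solve-∀

    leftDepth-fork : ∀ {k} → k ≤ length Q → leftDepth (fork k) ≡ suc k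
    leftDepth-fork {k} k≤ = begin
      leftDepth (fork k)                           ≡⟨ leftDepth-node′ g p _ ⟩
      suc (leftDepth (comb (take k Q) (leaf b)))   ≡⟨ cong suc (leftDepth-comb (take k Q) (leaf b)) ⟩
      suc (length (take k Q) + leftDepth (leaf b)) ≡⟨ cong₂ (λ l d → suc (l + d)) (length-take k Q) (leftDepth-leaf b) ⟩
      suc (k ⊓ length Q + 0)                       ≡⟨ cong suc (trans (+-identityʳ _) (m≤n⇒m⊓n≡m k≤)) ⟩
      suc k                                        ∎
      where open ≡-Reasoning

  forks : ∀ {n} (x : Piece) → 2 ≤ arity (symbol x) → (Q : List Piece) (b : Const) →
    (∀ j → occ Sg j (comb (x ∷ Q) (leaf b)) ≡ n j) →
    AtLeast (suc (length Q)) (λ u → HasContents Sg u n)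
  forks (piece g {zero}  p cs)       2≤arity Q b _ with subst (2 ≤_) p 2≤arity
  ... | s≤s ()
  forks (piece g {suc a} p (c ∷ cs)) _       Q b same =
    fork ∘ toℕ , fork-injective , λ k j → trans (occ-fork (toℕ k) j) (same j)
    where
      open Fork g p c cs Q b
      depth : ∀ k → leftDepth (fork (toℕ k)) ≡ suc (toℕ k)
      depth k = leftDepth-fork (≤-pred (toℕ<n k))
      fork-injective : Injective _≡_ _≡_ (fork ∘ toℕ)
      fork-injective {k} {l} eq =
        toℕ-injective (suc-injective (trans (sym (depth k)) (trans (cong leftDepth eq) (depth l))))

  sumBelow-pos : ∀ K n → 1 ≤ sumBelow Sg K n → ∃[ i ] (toℕ i < K × 1 ≤ n i)
  sumBelow-pos K n h = let i , hi = sum-tabulate-pos _ h in i , pos-if-does (toℕ i <? K) hi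

  sumBelow-≤ : ∀ K n (f : Fin S → ℕ) → (∀ i → toℕ i < K → n i ≤ f i) → sumBelow Sg K n ≤ Vec.sum (tabulate f)
  sumBelow-≤ K n f n≤f = sum-tabulate-mono (λ i → if-does-≤ (toℕ i <? K) (n≤f i))

  branching⇒nonconstant : ∀ {i} → toℕ i < B → 1 ≤ arity i
  branching⇒nonconstant {i} i<B = proj₂ (arity≥1⇔ i) (<-≤-trans i<B B≤F)

  module _ {t : Term Sg} {n : Fin S → ℕ} (t∶n : HasContents Sg t n) where

    contents-nonconstant : ∀ {j} → 1 ≤ arity j → n j ≡ countSymbol j (pieces t)
    contents-nonconstant {j} 1≤arity = begin
      n j                                               ≡⟨ t∶n j ⟨
      occ Sg j t                                        ≡⟨ occ-caterpillar j t ⟩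
      occ Sg j (comb (pieces t) (leaf (bottom t)))      ≡⟨ occ-comb j (pieces t) _ ⟩
      occPieces j (pieces t) + occ Sg j (leaf (bottom t)) ≡⟨ cong₂ _+_ (occPieces-nonconstant (pieces t) 1≤arity) (occ-leaf-nonconstant (bottom t) 1≤arity) ⟩
      countSymbol j (pieces t) + 0                      ≡⟨ +-identityʳ _ ⟩
      countSymbol j (pieces t)                          ∎
      where open ≡-Reasoning

    sumBelow-F≤length : sumBelow Sg F n ≤ length (pieces t)
    sumBelow-F≤length = begin
      sumBelow Sg F n                                           ≤⟨ sumBelow-≤ F n _ (λ j j<F → ≤-reflexive (contents-nonconstant (proj₂ (arity≥1⇔ j) j<F))) ⟩
      Vec.sum (tabulate (λ j → countSymbol j (pieces t)))        ≡⟨ sum-countSymbol (pieces t) ⟩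
      length (pieces t)                                         ∎
      where open ≤-Reasoning

    branchingPiece : 1 ≤ sumBelow Sg B n →
      ∃[ P₁ ] ∃[ x ] ∃[ P₂ ] (pieces t ≡ P₁ ++ x ∷ P₂ × 2 ≤ arity (symbol x))
    branchingPiece 1≤sum with sumBelow-pos B n 1≤sum
    ... | i , i<B , 1≤nᵢ with find (countSymbol-pos (pieces t) (subst (1 ≤_) (contents-nonconstant (branching⇒nonconstant i<B)) 1≤nᵢ))
    ...   | x , x∈P , refl with ∈-∃++ x∈P
    ...     | P₁ , P₂ , P≡ = P₁ , x , P₂ , P≡ , proj₂ (arity≥2⇔ (symbol x)) i<B

    distinctTerms : 1 ≤ sumBelow Sg B n → AtLeast (sumBelow Sg F n) (λ u → HasContents Sg u n)
    distinctTerms 1≤B with branchingPiece 1≤B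
    ... | P₁ , y , P₂ , t≡ , 2≤arity = AtLeast-≤ {P = λ u → HasContents Sg u n} F≤ (forks y 2≤arity (P₁ ++ P₂) (bottom t) same)
      where
        F≤ : sumBelow Sg F n ≤ suc (length (P₁ ++ P₂))
        F≤ = ≤-trans sumBelow-F≤length (≤-reflexive (trans (cong length t≡) (length-++-sucʳ P₁ y P₂)))
        same : ∀ j → occ Sg j (comb (y ∷ P₁ ++ P₂) (leaf (bottom t))) ≡ n j
        same j = begin
          occ Sg j (comb (y ∷ P₁ ++ P₂) (leaf (bottom t))) ≡⟨ occ-comb-↭ j _ (shift y P₁ P₂) ⟨
          occ Sg j (comb (P₁ ++ y ∷ P₂) (leaf (bottom t))) ≡⟨ cong (λ P → occ Sg j (comb P (leaf (bottom t)))) t≡ ⟨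
          occ Sg j (comb (pieces t) (leaf (bottom t)))     ≡⟨ occ-caterpillar j t ⟨
          occ Sg j t                                       ≡⟨ t∶n j ⟩
          n j                                              ∎
          where open ≡-Reasoning

lemma13 : (Sg : Signature) → (x : ℕ) → (n : Fin (Signature.S Sg) → ℕ) → (N : ℕ)
    → (∃[ t ] (weight Sg t ≡ x × HasContents Sg t n))
    → 1 ≤ sumBelow Sg (Signature.B Sg) n
    → N ≤ sumBelow Sg (Signature.F Sg) n
    → Σ[ f ∈ (Fin N → Term Sg) ] (Injective _≡_ _≡_ f × (∀ k → HasContents Sg (f k) n))
lemma13 Sg _ n N (t , _ , t∶n) 1≤B N≤F = AtLeast-≤ {P = λ u → HasContents Sg u n} N≤F (Caterpillars.distinctTerms Sg {t} t∶n 1≤B)
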